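{- Let $q>1$ and $n\ge 1$ be integers. There exists a $(2q-2)$-layer latin $(n+1)$-cuboid of order $q$ that has no transversal.
   Context: Let $Q_q=\{0,\dots,q-1\}$. A latin $n$-cube of order $q$ is a map $Q_q^n\to Q_q$ such that every line (cells obtained by fixing all coordinates but one) contains all $q$ symbols. For $k\ge 1$, a $k$-layer latin $(n+1)$-cuboid of order $q$ is an array $C$ of size $k\times q\times\cdots\times q$ ($n+1$ dimensions) with entries in $Q_q$ such that for each fixed value $l$ of the first coordinate, the layer $(x_1,\dots,x_n)\mapsto C(l,x_1,\dots,x_n)$ is a latin $n$-cube of order $q$. A hyperplane of $C$ is the set of cells obtained by fixing any one of its $n+1$ coordinates at one value. For $k\ge q$, a transversal of $C$ is a set of $q$ cells such that every hyperplane contains at most one of these cells and the symbols in these cells are pairwise distinct. -}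

module Defs where

open import Data.Nat using (ℕ)
open import Data.Fin using (Fin; _≟_)
open import Data.Product using (Σ; ∃; _×_; proj₁; proj₂)
open import Relation.Binary.PropositionalEquality using (_≡_)
open import Relation.Nullary using (¬_)
open import Relation.Nullary.Decidable using (does)
open import Data.Bool using (if_then_else_)

Point : ℕ → ℕ → Set
Point n q = Fin n → Fin q

update : ∀ {n q} → Point n q → Fin n → Fin q → Point n q
update x i a j = if does (j ≟ i) then a else x j

LatinCube : (n q : ℕ) → Set
LatinCube n q = Point n q → Fin q

IsLatin : ∀ {n q} → LatinCube n q → Set
IsLatin {n} {q} f =
  (i : Fin n) (x : Point n q) (s : Fin q) → ∃ λ a → f (update x i a) ≡ s

Cuboid : (k n q : ℕ) → Set
Cuboid k n q = Fin k → Point n q → Fin q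

IsLatinCuboid : ∀ {k n q} → Cuboid k n q → Set
IsLatinCuboid {k} C = (l : Fin k) → IsLatin (C l)

Cell : (k n q : ℕ) → Set
Cell k n q = Fin k × Point n q

-- A transversal: q cells (indexed by Fin q) such that every hyperplane
-- contains at most one of them, and whose symbols are pairwise distinct.
-- A hyperplane fixes one coordinate at one value, so "at most one cell per
-- hyperplane" means: two cells with distinct indices differ in the layer
-- coordinate and in every other coordinate. (This also forces the q cells
-- to be distinct.)
IsTransversal : ∀ {k n q} → Cuboid k n q → (Fin q → Cell k n q) → Set
IsTransversal {k} {n} {q} C T =
  ((t t′ : Fin q) → ¬ t ≡ t′ →
     (¬ proj₁ (T t) ≡ proj₁ (T t′)) ×
     ((i : Fin n) → ¬ proj₂ (T t) i ≡ proj₂ (T t′) i) ×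
     (¬ C (proj₁ (T t)) (proj₂ (T t)) ≡ C (proj₁ (T t′)) (proj₂ (T t′))))

HasTransversal : ∀ {k n q} → Cuboid k n q → Set
HasTransversal {k} {n} {q} C = ∃ λ (T : Fin q → Cell k n q) → IsTransversal C T

-- Give layer l the symbols (x₁ + ⋯ + xₙ + shift l) mod q. Every layer is latin, and along a
-- transversal both the coordinates and the symbols run through all of Q_q, so
-- n·S + Σ_t shift(l_t) ≡ S (mod q), where S = 0 + 1 + ⋯ + (q-1). If n·S ≢ S (mod q) the
-- unshifted cuboid already has no transversal. Otherwise shift layer l by ⌊l/(q-1)⌋, i.e. by
-- 1 on the upper half of the 2q-2 layers: the q distinct layers of a transversal cannot all
-- fit into one half, so the total shift lies strictly between 0 and q, contradicting
-- Σ_t shift(l_t) ≡ 0 (mod q).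
module Submission where

open import Defs
open import Data.Nat using (ℕ; zero; suc; _+_; _*_; _∸_; _≤_; _<_; _%_; _/_; NonZero; s≤s; z≤n; s≤s⁻¹)
open import Data.Nat.Properties
  using (+-0-commutativeMonoid; +-commutativeSemigroup; +-assoc; +-comm; +-identityʳ; +-mono-≤;
         ≤-trans; ≤-reflexive; 1+n≰n; ≤∧≢⇒<; m≤m+n; m+[n∸m]≡n; <-irrefl; n≢0⇒n>0; *-distribˡ-∸)
  renaming (_≟_ to _≟ℕ_)
open import Data.Nat.DivMod
  using (_mod_; %-distribˡ-+; m%n≤n; m%n%n≡m%n; [m+kn]%n≡m%n; m≡m%n+[m/n]*n; m<n⇒m%n≡m; m<n*o⇒m/o<n)
open import Data.Fin using (Fin; zero; suc; toℕ; punchIn; punchOut; _≟_)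
open import Data.Fin.Properties
  using (toℕ-fromℕ<; toℕ-injective; toℕ<n; punchIn-punchOut; punchOut-injective; punchInᵢ≢i;
         injective⇒≤; ¬∀⟶∃¬; suc-injective; 0≢1+n)
open import Data.Vec.Functional using (removeAt)
open import Data.Product using (Σ; ∃; _×_; _,_; proj₁; proj₂)
open import Function using (_∘_)
open import Function.Definitions using (Injective)
open import Relation.Binary.PropositionalEquality
open import Relation.Nullary using (¬_; yes; no)
open import Relation.Nullary.Decidable using (dec-true; dec-false; decidable-stable)
open import Algebra.Properties.CommutativeMonoid.Sum +-0-commutativeMonoid
  using (sum; sum-syntax; sum-remove; ∑-distrib-+; ∑-comm; sum-cong-≗; sum-replicate-zero)
open import Algebra.Properties.CommutativeSemigroup +-commutativeSemigroup using (xy∙z≈xz∙y)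

open ≡-Reasoning

∑-injective : ∀ {m} (f : Fin m → ℕ) {g : Fin m → Fin m} → Injective _≡_ _≡_ g →
  ∑[ i < m ] f (g i) ≡ ∑[ i < m ] f i
∑-injective {zero} f _ = refl
∑-injective {suc m} f {g} g-inj = begin
  f (g zero) + ∑[ i < m ] f (g (suc i))
    ≡⟨ cong (f (g zero) +_) (sum-cong-≗ λ i → cong f (punchIn-punchOut (g₀≢ i))) ⟨
  f (g zero) + ∑[ i < m ] removeAt f (g zero) (g′ i)
    ≡⟨ cong (f (g zero) +_) (∑-injective (removeAt f (g zero)) g′-inj) ⟩
  f (g zero) + ∑[ i < m ] removeAt f (g zero) i
    ≡⟨ sum-remove f ⟨
  ∑[ i < suc m ] f i ∎
  where
  g₀≢ : ∀ i → g zero ≢ g (suc i)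
  g₀≢ i = 0≢1+n ∘ g-inj
  g′ : Fin m → Fin m
  g′ i = punchOut (g₀≢ i)
  g′-inj : Injective _≡_ _≡_ g′
  g′-inj eq = suc-injective (g-inj (punchOut-injective (g₀≢ _) (g₀≢ _) eq))

≤-∑ : ∀ {m} (f : Fin (suc m) → ℕ) i → f i ≤ sum f
≤-∑ f i = ≤-trans (m≤m+n (f i) _) (≤-reflexive (sym (sum-remove {i = i} f)))

∑-≤ : ∀ {m} (f : Fin m → ℕ) → (∀ i → f i ≤ 1) → sum f ≤ m
∑-≤ {zero} f _ = z≤n
∑-≤ {suc m} f f≤1 = +-mono-≤ (f≤1 zero) (∑-≤ (f ∘ suc) (f≤1 ∘ suc))

%-cong-+ : ∀ {m n o p} d .{{_ : NonZero d}} → m % d ≡ o % d → n % d ≡ p % d →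
  (m + n) % d ≡ (o + p) % d
%-cong-+ {m} {n} {o} {p} d m≡o n≡p = begin
  (m + n) % d          ≡⟨ %-distribˡ-+ m n d ⟩
  (m % d + n % d) % d  ≡⟨ cong₂ (λ a b → (a + b) % d) m≡o n≡p ⟩
  (o % d + p % d) % d  ≡⟨ %-distribˡ-+ o p d ⟨
  (o + p) % d          ∎

%-distrib-∑ : ∀ {m} (f : Fin m → ℕ) d .{{_ : NonZero d}} →
  (∑[ i < m ] f i) % d ≡ (∑[ i < m ] (f i % d)) % d
%-distrib-∑ {zero} f d = refl
%-distrib-∑ {suc m} f d = %-cong-+ d (sym (m%n%n≡m%n (f zero) d)) (%-distrib-∑ (f ∘ suc) d)

[m+n+[d∸n%d]]%d≡m%d : ∀ m n d .{{_ : NonZero d}} → (m + n + (d ∸ n % d)) % d ≡ m % d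
[m+n+[d∸n%d]]%d≡m%d m n d = begin
  (m + n + (d ∸ n % d)) % d    ≡⟨ cong (_% d) (+-assoc m n _) ⟩
  (m + (n + (d ∸ n % d))) % d  ≡⟨ cong (λ a → (m + a) % d) n+[d∸n%d]≡[1+n/d]*d ⟩
  (m + suc (n / d) * d) % d    ≡⟨ [m+kn]%n≡m%n m (suc (n / d)) d ⟩
  m % d                        ∎
  where
  n+[d∸n%d]≡[1+n/d]*d : n + (d ∸ n % d) ≡ suc (n / d) * d
  n+[d∸n%d]≡[1+n/d]*d = begin
    n + (d ∸ n % d)                  ≡⟨ cong (_+ (d ∸ n % d)) (m≡m%n+[m/n]*n n d) ⟩
    n % d + n / d * d + (d ∸ n % d)  ≡⟨ xy∙z≈xz∙y (n % d) (n / d * d) _ ⟩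
    n % d + (d ∸ n % d) + n / d * d  ≡⟨ cong (_+ n / d * d) (m+[n∸m]≡n (m%n≤n n d)) ⟩
    d + n / d * d                    ∎

[m+o]%d≡[n+o]%d⇒m%d≡n%d : ∀ {m n} o d .{{_ : NonZero d}} →
  (m + o) % d ≡ (n + o) % d → m % d ≡ n % d
[m+o]%d≡[n+o]%d⇒m%d≡n%d {m} {n} o d eq = begin
  m % d                        ≡⟨ [m+n+[d∸n%d]]%d≡m%d m o d ⟨
  (m + o + (d ∸ o % d)) % d    ≡⟨ %-cong-+ d eq refl ⟩
  (n + o + (d ∸ o % d)) % d    ≡⟨ [m+n+[d∸n%d]]%d≡m%d n o d ⟩
  n % d                        ∎

+-mod-surjective : ∀ m d .{{_ : NonZero d}} (s : Fin d) → ∃ λ (a : Fin d) → (toℕ a + m) mod d ≡ s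
+-mod-surjective m d s = a , toℕ-injective (begin
  toℕ ((toℕ a + m) mod d)       ≡⟨ toℕ-fromℕ< _ ⟩
  (toℕ a + m) % d               ≡⟨ %-cong-+ d (trans (cong (_% d) (toℕ-fromℕ< _)) (m%n%n≡m%n _ d)) refl ⟩
  (toℕ s + m′ + m) % d          ≡⟨ cong (_% d) (xy∙z≈xz∙y (toℕ s) m′ m) ⟩
  (toℕ s + m + m′) % d          ≡⟨ [m+n+[d∸n%d]]%d≡m%d (toℕ s) m d ⟩
  toℕ s % d                     ≡⟨ m<n⇒m%n≡m (toℕ<n s) ⟩
  toℕ s                         ∎)
  where
  m′ : ℕ
  m′ = d ∸ m % d
  a : Fin d
  a = (toℕ s + m′) mod d

weight : ∀ {n q} → Point n q → ℕ
weight {n} x = ∑[ j < n ] toℕ (x j)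

update-≡ : ∀ {n q} (x : Point n q) i a → update x i a i ≡ a
update-≡ x i a rewrite dec-true (i ≟ i) refl = refl

update-≢ : ∀ {n q} (x : Point n q) {i j} a → j ≢ i → update x i a j ≡ x j
update-≢ x {i} {j} a j≢i rewrite dec-false (j ≟ i) j≢i = refl

weight-update : ∀ {n q} (x : Point (suc n) q) i a →
  weight (update x i a) ≡ toℕ a + ∑[ j < n ] removeAt (toℕ ∘ x) i j
weight-update {n} x i a = begin
  weight (update x i a)
    ≡⟨ sum-remove {i = i} (toℕ ∘ update x i a) ⟩
  toℕ (update x i a i) + ∑[ j < n ] toℕ (update x i a (punchIn i j))
    ≡⟨ cong₂ _+_ (cong toℕ (update-≡ x i a)) (sum-cong-≗ λ j → cong toℕ (update-≢ x a (punchInᵢ≢i i j))) ⟩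
  toℕ a + ∑[ j < n ] removeAt (toℕ ∘ x) i j ∎

shiftedCuboid : ∀ {k n q} .{{_ : NonZero q}} → (Fin k → ℕ) → Cuboid k n q
shiftedCuboid {q = q} shift l x = (weight x + shift l) mod q

shiftedCuboid-isLatin : ∀ {k n q} .{{_ : NonZero q}} (shift : Fin k → ℕ) →
  IsLatinCuboid {k} {n} {q} (shiftedCuboid shift)
shiftedCuboid-isLatin {n = suc n} {q} shift l i x s = a , (begin
  (weight (update x i a) + shift l) mod q  ≡⟨ cong (λ w → (w + shift l) mod q) (weight-update x i a) ⟩
  (toℕ a + rest + shift l) mod q           ≡⟨ cong (_mod q) (+-assoc (toℕ a) rest (shift l)) ⟩
  (toℕ a + (rest + shift l)) mod q         ≡⟨ a-hits-s ⟩
  s                                        ∎)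
  where
  rest : ℕ
  rest = ∑[ j < n ] removeAt (toℕ ∘ x) i j
  a : Fin q
  a = proj₁ (+-mod-surjective (rest + shift l) q s)
  a-hits-s : (toℕ a + (rest + shift l)) mod q ≡ s
  a-hits-s = proj₂ (+-mod-surjective (rest + shift l) q s)

distinct⇒injective : ∀ {m} {A : Set} (g : Fin m → A) →
  (∀ t t′ → t ≢ t′ → g t ≢ g t′) → Injective _≡_ _≡_ g
distinct⇒injective g distinct {t} {t′} eq =
  decidable-stable (t ≟ t′) (λ t≢t′ → distinct t t′ t≢t′ eq)

module _ {k n q} (C : Cuboid k n q) {T : Fin q → Cell k n q} (T-transversal : IsTransversal C T) where

  transversal-layer-injective : Injective _≡_ _≡_ (proj₁ ∘ T)
  transversal-layer-injective =
    distinct⇒injective _ λ t t′ t≢t′ → proj₁ (T-transversal t t′ t≢t′)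

  transversal-coordinate-injective : ∀ j → Injective _≡_ _≡_ (λ t → proj₂ (T t) j)
  transversal-coordinate-injective j =
    distinct⇒injective _ λ t t′ t≢t′ → proj₁ (proj₂ (T-transversal t t′ t≢t′)) j

  transversal-symbol-injective : Injective _≡_ _≡_ (λ t → C (proj₁ (T t)) (proj₂ (T t)))
  transversal-symbol-injective =
    distinct⇒injective _ λ t t′ t≢t′ → proj₂ (proj₂ (T-transversal t t′ t≢t′))

∑Fin : ℕ → ℕ
∑Fin q = ∑[ i < q ] toℕ i

shiftedCuboid-transversal-% : ∀ {k n q} .{{_ : NonZero q}} (shift : Fin k → ℕ) {T : Fin q → Cell k n q} →
  IsTransversal (shiftedCuboid shift) T →
  (∑[ j < n ] ∑Fin q + ∑[ t < q ] shift (proj₁ (T t))) % q ≡ ∑Fin q % q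
shiftedCuboid-transversal-% {n = n} {q} shift {T} T-transversal = begin
  (∑[ j < n ] ∑Fin q + ∑[ t < q ] shift (layer t)) % q
    ≡⟨ cong (λ w → (w + ∑[ t < q ] shift (layer t)) % q) weights ⟨
  (∑[ t < q ] weight (point t) + ∑[ t < q ] shift (layer t)) % q
    ≡⟨ cong (_% q) (∑-distrib-+ (weight ∘ point) (shift ∘ layer)) ⟨
  (∑[ t < q ] (weight (point t) + shift (layer t))) % q
    ≡⟨ %-distrib-∑ (λ t → weight (point t) + shift (layer t)) q ⟩
  (∑[ t < q ] ((weight (point t) + shift (layer t)) % q)) % q
    ≡⟨ cong (_% q) (sum-cong-≗ {q} λ t → toℕ-fromℕ< _) ⟨
  (∑[ t < q ] toℕ (symbol t)) % q
    ≡⟨ cong (_% q) (∑-injective toℕ (transversal-symbol-injective (shiftedCuboid shift) T-transversal)) ⟩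
  ∑Fin q % q ∎
  where
  layer : Fin q → Fin _
  layer = proj₁ ∘ T
  point : Fin q → Point n q
  point = proj₂ ∘ T
  symbol : Fin q → Fin q
  symbol t = shiftedCuboid shift (layer t) (point t)
  weights : ∑[ t < q ] weight (point t) ≡ ∑[ j < n ] ∑Fin q
  weights = begin
    ∑[ t < q ] ∑[ j < n ] toℕ (point t j)
      ≡⟨ ∑-comm (λ t j → toℕ (point t j)) ⟩
    ∑[ j < n ] ∑[ t < q ] toℕ (point t j)
      ≡⟨ sum-cong-≗ (λ j → ∑-injective toℕ (transversal-coordinate-injective (shiftedCuboid shift) T-transversal j)) ⟩
    ∑[ j < n ] ∑Fin q ∎

unshiftedCuboid-noTransversal : ∀ {k n q} .{{_ : NonZero q}} →
  (∑[ j < n ] ∑Fin q) % q ≢ ∑Fin q % q → ¬ HasTransversal (shiftedCuboid {k} {n} {q} (λ _ → 0))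
unshiftedCuboid-noTransversal {n = n} {q} nS≢S (T , T-transversal) = nS≢S (begin
  (∑[ j < n ] ∑Fin q) % q                           ≡⟨ cong (_% q) (+-identityʳ _) ⟨
  (∑[ j < n ] ∑Fin q + 0) % q                       ≡⟨ cong (λ z → (∑[ j < n ] ∑Fin q + z) % q) (sum-replicate-zero q) ⟨
  (∑[ j < n ] ∑Fin q + ∑[ t < q ] 0) % q            ≡⟨ shiftedCuboid-transversal-% (λ _ → 0) T-transversal ⟩
  ∑Fin q % q                                        ∎)

injective-same-quotient⇒≤ : ∀ {m k} b .{{_ : NonZero b}} {L : Fin m → Fin k} → Injective _≡_ _≡_ L →
  ∀ β → (∀ t → toℕ (L t) / b ≡ β) → m ≤ b
injective-same-quotient⇒≤ b {L} L-inj β same = injective⇒≤ {f = λ t → toℕ (L t) mod b} λ {t} {t′} eq →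
  L-inj (toℕ-injective (begin
    toℕ (L t)                            ≡⟨ m≡m%n+[m/n]*n (toℕ (L t)) b ⟩
    toℕ (L t) % b + toℕ (L t) / b * b
      ≡⟨ cong₂ (λ r s → r + s * b) (remainders eq) (trans (same t) (sym (same t′))) ⟩
    toℕ (L t′) % b + toℕ (L t′) / b * b  ≡⟨ m≡m%n+[m/n]*n (toℕ (L t′)) b ⟨
    toℕ (L t′)                           ∎))
  where
  remainders : ∀ {t t′} → toℕ (L t) mod b ≡ toℕ (L t′) mod b → toℕ (L t) % b ≡ toℕ (L t′) % b
  remainders eq = trans (sym (toℕ-fromℕ< _)) (trans (cong toℕ eq) (toℕ-fromℕ< _))

half : ∀ p → Fin (2 * suc (suc p) ∸ 2) → ℕ
half p l = toℕ l / suc p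

half≤1 : ∀ p l → half p l ≤ 1
half≤1 p l = s≤s⁻¹ (m<n*o⇒m/o<n (subst (toℕ l <_) (sym (*-distribˡ-∸ 2 (suc (suc p)) 1)) (toℕ<n l)))

steppedCuboid-noTransversal : ∀ p n → let q = suc (suc p) in
  (∑[ j < n ] ∑Fin q) % q ≡ ∑Fin q % q → ¬ HasTransversal (shiftedCuboid {n = n} {q} (half p))
steppedCuboid-noTransversal p n nS≡S (T , T-transversal) = <-irrefl (sym M≡0) 0<M
  where
  q : ℕ
  q = suc (suc p)
  layer : Fin q → Fin (2 * q ∸ 2)
  layer = proj₁ ∘ T
  M : ℕ
  M = ∑[ t < q ] half p (layer t)

  M%q≡0 : M % q ≡ 0
  M%q≡0 = [m+o]%d≡[n+o]%d⇒m%d≡n%d {M} {0} (∑Fin q) q (begin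
    (M + ∑Fin q) % q             ≡⟨ %-cong-+ {M} {∑Fin q} {M} q refl (sym nS≡S) ⟩
    (M + ∑[ j < n ] ∑Fin q) % q  ≡⟨ cong (_% q) (+-comm M _) ⟩
    (∑[ j < n ] ∑Fin q + M) % q  ≡⟨ shiftedCuboid-transversal-% (half p) T-transversal ⟩
    ∑Fin q % q                   ∎)

  some-half≢ : ∀ β → ∃ λ t → half p (layer t) ≢ β
  some-half≢ β = ¬∀⟶∃¬ q _ (λ t → half p (layer t) ≟ℕ β) λ all-β →
    1+n≰n (injective-same-quotient⇒≤ (suc p) layer-injective β all-β)
    where
    layer-injective : Injective _≡_ _≡_ layer
    layer-injective = transversal-layer-injective (shiftedCuboid (half p)) T-transversal

  0<M : 0 < M
  0<M = let t , upper = some-half≢ 0 in ≤-trans (n≢0⇒n>0 upper) (≤-∑ (half p ∘ layer) t)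

  M<q : M < q
  M<q = let t , lower = some-half≢ 1 in s≤s (≤-trans (≤-reflexive (sum-remove {i = t} (half p ∘ layer)))
    (+-mono-≤ (s≤s⁻¹ (≤∧≢⇒< (half≤1 p (layer t)) lower))
              (∑-≤ (removeAt (half p ∘ layer) t) (λ i → half≤1 p (layer (punchIn t i))))))

  M≡0 : M ≡ 0
  M≡0 = trans (sym (m<n⇒m%n≡m M<q)) M%q≡0

theorem3 : (q n : ℕ) → 1 < q → 1 ≤ n →
    Σ (Cuboid (2 * q ∸ 2) n q) λ C → IsLatinCuboid C × ¬ HasTransversal C
theorem3 (suc (suc p)) n (s≤s (s≤s z≤n)) _
  with (∑[ j < n ] ∑Fin (suc (suc p))) % suc (suc p) ≟ℕ ∑Fin (suc (suc p)) % suc (suc p)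
... | yes nS≡S = shiftedCuboid (half p) , shiftedCuboid-isLatin (half p) , steppedCuboid-noTransversal p n nS≡S
... | no nS≢S  = shiftedCuboid (λ _ → 0) , shiftedCuboid-isLatin (λ _ → 0) , unshiftedCuboid-noTransversal nS≢S
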